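{- Let $n\ge 1$ and let $\pi=\pi_1\pi_2\cdots\pi_n\in\mathfrak{S}_n$ (one-line notation). Partition its ascent set $\mathrm{Asc}(\pi)=\{i\in[n-1]:\pi_i<\pi_{i+1}\}$ into maximal blocks $b_1,b_2,\ldots,b_k$ of consecutive integers. Then the number of Boolean intervals $[\pi,w]$ in the right weak order $W(\mathfrak{S}_n)$ with minimal element $\pi$ and arbitrary maximal element $w$ (including the case $w=\pi$) equals $$\prod_{i=1}^k F_{|b_i|+2},$$ where $F_\ell$ is the $\ell$-th Fibonacci number with $F_1=F_2=1$ (an empty product equals $1$).
   Context: $[n]=\{1,\ldots,n\}$. $s_i=(i,i+1)$ denotes a simple transposition. The right weak order $W(\mathfrak{S}_n)$ is the partial order on $\mathfrak{S}_n$ whose cover relations are $\tau\lessdot\tau s_i$ whenever $\tau(i)<\tau(i+1)$ (i.e. right multiplication by $s_i$ swaps two adjacent entries in increasing position order into decreasing order); its order relation is the transitive closure. An interval $[v,w]=\{u: v\le u\le w\}$ (with $v\le w$) is called a Boolean interval (of rank $k$) if it is isomorphic as a poset to the lattice of all subsets of a $k$-element set ordered by inclusion; $[\pi,\pi]$ is a Boolean interval of rank $0$. -}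

module Defs where

open import Data.Nat using (ℕ; zero; suc; _+_; _*_)
open import Data.Bool using (Bool; true; false)
open import Data.Fin using (Fin; toℕ) renaming (_<_ to _<ᶠ_)
open import Data.Fin.Subset using (Subset; _⊆_)
open import Data.Vec using (Vec; []; _∷_; lookup; toList)
open import Data.List using (List; []; _∷_; _++_; map)
open import Data.Nat.ListAction using (product)
open import Data.Nat using (_<ᵇ_)
open import Data.Product using (Σ; _×_; ∃)
open import Relation.Binary.PropositionalEquality using (_≡_)
open import Relation.Binary.Construct.Closure.ReflexiveTransitive using (Star)
open import Function.Definitions using (Injective)
open import Function.Bundles using (_⇔_)

-- Elements of 𝔖ₙ in one-line notation: a vector (π₁ … πₙ) of entries in Fin n
-- whose lookup map is injective (hence a bijection of Fin n).
IsPerm : ∀ {n} → Vec (Fin n) n → Set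
IsPerm v = Injective _≡_ _≡_ (lookup v)

-- Cover relation of the right weak order: τ ⋖ τ sᵢ when τ(i) < τ(i+1);
-- right multiplication by sᵢ swaps the entries in positions i, i+1.
data Cover {n : ℕ} : ∀ {m} → Vec (Fin n) m → Vec (Fin n) m → Set where
  here  : ∀ {m x y} {xs : Vec (Fin n) m} → x <ᶠ y → Cover (x ∷ y ∷ xs) (y ∷ x ∷ xs)
  there : ∀ {m x} {xs ys : Vec (Fin n) m} → Cover xs ys → Cover (x ∷ xs) (x ∷ ys)

_≤W_ : ∀ {n} → Vec (Fin n) n → Vec (Fin n) n → Set
u ≤W w = Star Cover u w

InInterval : ∀ {n} → Vec (Fin n) n → Vec (Fin n) n → Vec (Fin n) n → Set
InInterval v w u = IsPerm u × (v ≤W u) × (u ≤W w)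

IsBoolean : ∀ {n} → Vec (Fin n) n → Vec (Fin n) n → Set
IsBoolean {n} v w =
  (v ≤W w) ×
  Σ ℕ λ k → Σ (Subset k → Vec (Fin n) n) λ f →
    (∀ S → InInterval v w (f S)) ×
    (∀ u → InInterval v w u → ∃ λ S → f S ≡ u) ×
    (∀ S T → f S ≡ f T → S ≡ T) ×
    (∀ S T → (S ⊆ T) ⇔ (f S ≤W f T))

fib : ℕ → ℕ
fib zero = 0
fib (suc zero) = 1
fib (suc (suc n)) = fib (suc n) + fib n

ascBits : List ℕ → List Bool
ascBits [] = []
ascBits (x ∷ []) = []
ascBits (x ∷ y ∷ xs) = (x <ᵇ y) ∷ ascBits (y ∷ xs)

closeRun : ℕ → List ℕ
closeRun zero = []
closeRun (suc c) = suc c ∷ []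

-- lengths of the maximal runs of consecutive 'true's (c = current run length)
runs : ℕ → List Bool → List ℕ
runs c [] = closeRun c
runs c (true ∷ bs) = runs (suc c) bs
runs c (false ∷ bs) = closeRun c ++ runs 0 bs

ascBlockSizes : ∀ {n} → Vec (Fin n) n → List ℕ
ascBlockSizes π = runs 0 (ascBits (map toℕ (toList π)))

fibProduct : ∀ {n} → Vec (Fin n) n → ℕ
fibProduct π = product (map (λ b → fib (b + 2)) (ascBlockSizes π))

module Submission where

-- An interval [π, w] is Boolean exactly when w = π sᵢ₁ ⋯ sᵢₖ for pairwise non-adjacent
-- ascents i₁, …, iₖ of π; the elements of the interval are then the partial products, one
-- for each subset of these commuting swaps. Membership in [π, w] is decided by inversion sets:
-- a permutation whose inversions lie between those of π and w is such a partial product.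
-- Conversely, by induction on the rank: the facet below the top is a Boolean interval of
-- smaller rank, the top covers it by one ascent swap, and comparing with an atom shows that
-- this swap is disjoint from the facet's swaps. Choosing non-adjacent positions in a block of
-- c consecutive ascents can be done in F_{c+2} ways, independently for each block.

open import Defs
open import Data.Bool using (Bool; true; false; T)
open import Data.Empty using (⊥; ⊥-elim)
open import Data.Fin using (Fin; toℕ) renaming (_<_ to _<ᶠ_)
open import Data.Fin.Properties using (<-cmp; <-irrefl; <-asym; suc-injective)
open import Data.Fin.Subset using (Subset; _⊆_) renaming (⊥ to ∅; ⊤ to full)
open import Data.Fin.Subset.Properties using (drop-∷-⊆; out⊆; s⊆s; ⊥⊆; ⊆⊤; ⊆-antisym; ⊆-refl)
open import Data.List using (List; []; _∷_; _++_; map; length; replicate)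
open import Data.List.Membership.Propositional using (_∈_)
open import Data.List.Membership.Propositional.Properties using (∈-map⁺; ∈-map⁻; ∈-++⁺ˡ; ∈-++⁺ʳ; ∈-++⁻)
open import Data.List.Properties using (length-++; length-map; map-++; ++-identityʳ)
import Data.List.Relation.Unary.All as ListAll
import Data.List.Relation.Unary.AllPairs as AllPairs
import Data.List.Relation.Unary.Any as ListAny
open import Data.List.Relation.Unary.Unique.Propositional using (Unique)
import Data.List.Relation.Unary.Unique.Propositional.Properties as Unique
open import Data.Nat using (ℕ; zero; suc; _≤_; _+_; _*_; _<ᵇ_)
open import Data.Nat.ListAction using (product)
open import Data.Nat.ListAction.Properties using (product-++)
open import Data.Nat.Properties using (<ᵇ⇒<; <⇒<ᵇ; +-identityʳ; *-identityʳ; *-distribʳ-+; +-comm)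
open import Data.Product using (Σ; _×_; _,_; proj₁; proj₂; ∃)
open import Data.Sum using (_⊎_; inj₁; inj₂)
open import Data.Unit using (tt)
open import Data.Vec using (Vec; []; _∷_; lookup; toList)
import Data.Vec.Base as VecBase
open import Data.Vec.Membership.Propositional using () renaming (_∈_ to _∈ᵥ_; _∉_ to _∉ᵥ_)
open import Data.Vec.Properties using (∷-injectiveˡ; ∷-injectiveʳ)
open import Data.Vec.Membership.Propositional.Properties using (∈-lookup)
open import Data.Vec.Relation.Unary.Any using (here; there; index)
open import Data.Vec.Relation.Unary.Any.Properties using (lookup-index)
open import Function.Base using (_∘_)
open import Function.Bundles using (_⇔_; mk⇔; Equivalence)
open import Function.Definitions using (Injective)
open import Relation.Binary.Construct.Closure.ReflexiveTransitive using (Star; ε; _◅_; _◅◅_; gmap)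
open import Relation.Binary.Definitions using (tri<; tri≈; tri>)
open import Relation.Binary.PropositionalEquality using (_≡_; _≢_; refl; sym; trans; cong; cong₂; subst; module ≡-Reasoning)
open import Relation.Nullary using (¬_; contradiction)

private variable
  n m : ℕ
  a b c x y z : Fin n
  u v w t : Vec (Fin n) m

data Distinct {n : ℕ} : ∀ {m} → Vec (Fin n) m → Set where
  []  : Distinct []
  _∷_ : x ∉ᵥ v → Distinct v → Distinct (x ∷ v)

Distinct-head : Distinct (x ∷ v) → x ∉ᵥ v
Distinct-head (x∉v ∷ _) = x∉v

Distinct-tail : Distinct (x ∷ v) → Distinct v
Distinct-tail (_ ∷ d) = d

∉⇒≢ : x ∉ᵥ v → z ∈ᵥ v → z ≢ x
∉⇒≢ x∉v z∈v refl = x∉v z∈v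

Distinct⇒IsPerm : Distinct v → Injective _≡_ _≡_ (lookup v)
Distinct⇒IsPerm (_ ∷ _)        {Fin.zero}  {Fin.zero}  _ = refl
Distinct⇒IsPerm {v = _ ∷ v} (x∉v ∷ _) {Fin.zero}  {Fin.suc j} e = ⊥-elim (x∉v (subst (_∈ᵥ v) (sym e) (∈-lookup j v)))
Distinct⇒IsPerm {v = _ ∷ v} (x∉v ∷ _) {Fin.suc i} {Fin.zero}  e = ⊥-elim (x∉v (subst (_∈ᵥ v) e (∈-lookup i v)))
Distinct⇒IsPerm (_ ∷ d)        {Fin.suc i} {Fin.suc j} e = cong Fin.suc (Distinct⇒IsPerm d e)

IsPerm⇒Distinct : Injective _≡_ _≡_ (lookup v) → Distinct v
IsPerm⇒Distinct {v = []}    _   = []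
IsPerm⇒Distinct {v = x ∷ v} inj = x∉v ∷ IsPerm⇒Distinct (λ e → suc-injective (inj e))
  where
  x∉v : x ∉ᵥ v
  x∉v x∈v with inj {Fin.zero} {Fin.suc (index x∈v)} (lookup-index x∈v)
  ... | ()

data Before {n : ℕ} (b a : Fin n) : ∀ {m} → Vec (Fin n) m → Set where
  now   : a ∈ᵥ v → Before b a (b ∷ v)
  later : Before b a v → Before b a (x ∷ v)

Before-∈ˡ : Before b a v → b ∈ᵥ v
Before-∈ˡ (now _)   = here refl
Before-∈ˡ (later p) = there (Before-∈ˡ p)

Before-∈ʳ : Before b a v → a ∈ᵥ v
Before-∈ʳ (now a∈v) = there a∈v
Before-∈ʳ (later p) = there (Before-∈ʳ p)

Before-tail : Before b a (c ∷ v) → b ≢ c → Before b a v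
Before-tail (now _)   b≢b = ⊥-elim (b≢b refl)
Before-tail (later p) _   = p

Before-≢ : Distinct v → Before a b v → a ≢ b
Before-≢ (a∉v ∷ _) (now a∈v) refl = a∉v a∈v
Before-≢ (_ ∷ d)   (later p) e    = Before-≢ d p e

Before-asym : Distinct v → Before a b v → ¬ Before b a v
Before-asym (x∉v ∷ _) (now b∈v) (now a∈v) = x∉v a∈v
Before-asym (x∉v ∷ _) (now _)   (later q) = x∉v (Before-∈ʳ q)
Before-asym (x∉v ∷ _) (later p) (now _)   = x∉v (Before-∈ʳ p)
Before-asym (_ ∷ d)   (later p) (later q) = Before-asym d p q

Before-total : a ∈ᵥ v → b ∈ᵥ v → a ≢ b → Before a b v ⊎ Before b a v
Before-total (here refl) (here refl) a≢b = ⊥-elim (a≢b refl)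
Before-total (here refl) (there b∈v) _   = inj₁ (now b∈v)
Before-total (there a∈v) (here refl) _   = inj₂ (now a∈v)
Before-total (there a∈v) (there b∈v) a≢b with Before-total a∈v b∈v a≢b
... | inj₁ p = inj₁ (later p)
... | inj₂ p = inj₂ (later p)

¬Before-head : x ∉ᵥ v → ¬ Before c x (x ∷ v)
¬Before-head x∉v (now x∈v) = x∉v x∈v
¬Before-head x∉v (later p) = x∉v (Before-∈ʳ p)

Before-second : Distinct (x ∷ y ∷ v) → Before c y (x ∷ y ∷ v) → c ≡ x
Before-second _ (now _)   = refl
Before-second d (later p) = ⊥-elim (¬Before-head (Distinct-head (Distinct-tail d)) p)

_⊆Inv_ : Vec (Fin n) m → Vec (Fin n) m → Set
_⊆Inv_ {n} u v = ∀ {a b : Fin n} → a <ᶠ b → Before b a u → Before b a v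

data Swap {n : ℕ} (x y : Fin n) : ∀ {m} → Vec (Fin n) m → Vec (Fin n) m → Set where
  swap-head : Swap x y (x ∷ y ∷ v) (y ∷ x ∷ v)
  swap-tail : Swap x y u v → Swap x y (z ∷ u) (z ∷ v)

Swap-sym : Swap x y u v → Swap y x v u
Swap-sym swap-head     = swap-head
Swap-sym (swap-tail s) = swap-tail (Swap-sym s)

Swap-∈ : Swap x y u v → z ∈ᵥ u → z ∈ᵥ v
Swap-∈ swap-head     (here e)          = there (here e)
Swap-∈ swap-head     (there (here e))  = here e
Swap-∈ swap-head     (there (there p)) = there (there p)
Swap-∈ (swap-tail s) (here e)          = here e
Swap-∈ (swap-tail s) (there p)         = there (Swap-∈ s p)

Swap-∈⁻ : Swap x y u v → z ∈ᵥ v → z ∈ᵥ u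
Swap-∈⁻ s = Swap-∈ (Swap-sym s)

Swap-∈ˡ : Swap x y u v → x ∈ᵥ u
Swap-∈ˡ swap-head     = here refl
Swap-∈ˡ (swap-tail s) = there (Swap-∈ˡ s)

Swap-Distinct : Swap x y u v → Distinct u → Distinct v
Swap-Distinct swap-head (x∉ ∷ (y∉ ∷ d)) = y∉′ ∷ ((λ p → x∉ (there p)) ∷ d)
  where
  y∉′ : _ ∉ᵥ _
  y∉′ (here refl) = x∉ (here refl)
  y∉′ (there p)   = y∉ p
Swap-Distinct (swap-tail s) (z∉ ∷ d) = (λ p → z∉ (Swap-∈⁻ s p)) ∷ Swap-Distinct s d

Swap-⊆Inv : x <ᶠ y → Swap x y u v → u ⊆Inv v
Swap-⊆Inv x<y swap-head     a<b (now (here refl))  = ⊥-elim (<-asym x<y a<b)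
Swap-⊆Inv x<y swap-head     _   (now (there p))    = later (now p)
Swap-⊆Inv x<y swap-head     _   (later (now p))    = now (there p)
Swap-⊆Inv x<y swap-head     _   (later (later q))  = later (later q)
Swap-⊆Inv x<y (swap-tail s) _   (now p)            = now (Swap-∈ s p)
Swap-⊆Inv x<y (swap-tail s) a<b (later q)          = later (Swap-⊆Inv x<y s a<b q)

Swap-creates : Swap x y u v → Before y x v
Swap-creates swap-head     = now (here refl)
Swap-creates (swap-tail s) = later (Swap-creates s)

Swap-Before⁻ : Swap x y u v → Before b a v → Before b a u ⊎ (a ≡ x × b ≡ y)
Swap-Before⁻ swap-head     (now (here refl))  = inj₂ (refl , refl)
Swap-Before⁻ swap-head     (now (there p))    = inj₁ (later (now p))
Swap-Before⁻ swap-head     (later (now p))    = inj₁ (now (there p))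
Swap-Before⁻ swap-head     (later (later q))  = inj₁ (later (later q))
Swap-Before⁻ (swap-tail s) (now p)            = inj₁ (now (Swap-∈⁻ s p))
Swap-Before⁻ (swap-tail s) (later q) with Swap-Before⁻ s q
... | inj₁ r = inj₁ (later r)
... | inj₂ r = inj₂ r

Swap-≢ : x ≢ y → Swap x y u v → u ≢ v
Swap-≢ x≢y swap-head     refl = x≢y refl
Swap-≢ x≢y (swap-tail s) refl = Swap-≢ x≢y s refl

record AscentSwap {n m : ℕ} (u v : Vec (Fin n) m) : Set where
  constructor ascentSwap
  field
    {left right} : Fin n
    ascent       : left <ᶠ right
    swapped      : Swap left right u v

Cover⇒AscentSwap : Cover u v → AscentSwap u v
Cover⇒AscentSwap (here x<y) = ascentSwap x<y swap-head
Cover⇒AscentSwap (there c) with Cover⇒AscentSwap c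
... | ascentSwap x<y s = ascentSwap x<y (swap-tail s)

Cover⇒≢ : Cover u v → u ≢ v
Cover⇒≢ c with Cover⇒AscentSwap c
... | ascentSwap x<y s = Swap-≢ (λ e → <-irrefl e x<y) s

_≼_ : Vec (Fin n) m → Vec (Fin n) m → Set
u ≼ v = Star Cover u v

≼-∷ : u ≼ v → (x ∷ u) ≼ (x ∷ v)
≼-∷ = gmap _ there

≼-uncons : u ≼ v → u ≡ v ⊎ ∃ λ t → Cover u t × t ≼ v
≼-uncons ε       = inj₁ refl
≼-uncons (c ◅ p) = inj₂ (_ , c , p)

≼-∈ : u ≼ v → z ∈ᵥ u → z ∈ᵥ v
≼-∈ ε       z∈u = z∈u
≼-∈ (c ◅ p) z∈u = ≼-∈ p (Swap-∈ (AscentSwap.swapped (Cover⇒AscentSwap c)) z∈u)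

≼-∈⁻ : u ≼ v → z ∈ᵥ v → z ∈ᵥ u
≼-∈⁻ ε       z∈v = z∈v
≼-∈⁻ (c ◅ p) z∈v = Swap-∈⁻ (AscentSwap.swapped (Cover⇒AscentSwap c)) (≼-∈⁻ p z∈v)

≼-Distinct : u ≼ v → Distinct u → Distinct v
≼-Distinct ε       d = d
≼-Distinct (c ◅ p) d = ≼-Distinct p (Swap-Distinct (AscentSwap.swapped (Cover⇒AscentSwap c)) d)

≼-⊆Inv : u ≼ v → u ⊆Inv v
≼-⊆Inv ε       _   q = q
≼-⊆Inv (c ◅ p) a<b q with Cover⇒AscentSwap c
... | ascentSwap x<y s = ≼-⊆Inv p a<b (Swap-⊆Inv x<y s a<b q)

∈-∷⁻ : z ∈ᵥ (c ∷ v) → z ≢ c → z ∈ᵥ v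
∈-∷⁻ (here refl) z≢z = ⊥-elim (z≢z refl)
∈-∷⁻ (there z∈v) _   = z∈v

-- v = u sᵢ₁ ⋯ sᵢₖ for ascents i₁ < ⋯ < iₖ of u with iⱼ₊₁ > iⱼ + 1.
data DisjointSwaps {n : ℕ} : ∀ {m} → Vec (Fin n) m → Vec (Fin n) m → Set where
  []   : DisjointSwaps [] []
  keep : ∀ x → DisjointSwaps u v → DisjointSwaps (x ∷ u) (x ∷ v)
  swap : x <ᶠ y → DisjointSwaps u v → DisjointSwaps (x ∷ y ∷ u) (y ∷ x ∷ v)

#swaps : DisjointSwaps u v → ℕ
#swaps []         = 0
#swaps (keep _ d) = #swaps d
#swaps (swap _ d) = suc (#swaps d)

applySwaps : {u v : Vec (Fin n) m} (d : DisjointSwaps u v) → Subset (#swaps d) → Vec (Fin n) m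
applySwaps []                     []      = []
applySwaps (keep x d)             S       = x ∷ applySwaps d S
applySwaps (swap {x = x} {y} _ d) (true ∷ S)  = y ∷ x ∷ applySwaps d S
applySwaps (swap {x = x} {y} _ d) (false ∷ S) = x ∷ y ∷ applySwaps d S

noSwaps : (v : Vec (Fin n) m) → DisjointSwaps v v
noSwaps []      = []
noSwaps (x ∷ v) = keep x (noSwaps v)

applyNoSwaps : (v : Vec (Fin n) m) (S : Subset (#swaps (noSwaps v))) → applySwaps (noSwaps v) S ≡ v
applyNoSwaps []      [] = refl
applyNoSwaps (x ∷ v) S  = cong (x ∷_) (applyNoSwaps v S)

applySwaps-∅ : (d : DisjointSwaps u v) → applySwaps d ∅ ≡ u
applySwaps-∅ []                     = refl
applySwaps-∅ (keep x d)             = cong (x ∷_) (applySwaps-∅ d)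
applySwaps-∅ (swap {x = x} {y} _ d) = cong (λ r → x ∷ y ∷ r) (applySwaps-∅ d)

applySwaps-⊤ : (d : DisjointSwaps u v) → applySwaps d full ≡ v
applySwaps-⊤ []                     = refl
applySwaps-⊤ (keep x d)             = cong (x ∷_) (applySwaps-⊤ d)
applySwaps-⊤ (swap {x = x} {y} _ d) = cong (λ r → y ∷ x ∷ r) (applySwaps-⊤ d)

true∷⊈false∷ : {S T : Subset m} → ¬ (true ∷ S) ⊆ (false ∷ T)
true∷⊈false∷ sub with sub VecBase.here
... | ()

applySwaps-mono : (d : DisjointSwaps u v) {S T : Subset (#swaps d)} → S ⊆ T → applySwaps d S ≼ applySwaps d T
applySwaps-mono []                        {[]}      {[]}      _   = ε
applySwaps-mono (keep x d)                          S⊆T = ≼-∷ (applySwaps-mono d S⊆T)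
applySwaps-mono (swap x<y d) {false ∷ S} {false ∷ T} S⊆T = ≼-∷ (≼-∷ (applySwaps-mono d (drop-∷-⊆ S⊆T)))
applySwaps-mono (swap x<y d) {true ∷ S}  {true ∷ T}  S⊆T = ≼-∷ (≼-∷ (applySwaps-mono d (drop-∷-⊆ S⊆T)))
applySwaps-mono (swap x<y d) {false ∷ S} {true ∷ T}  S⊆T = here x<y ◅ ≼-∷ (≼-∷ (applySwaps-mono d (drop-∷-⊆ S⊆T)))
applySwaps-mono (swap x<y d) {true ∷ S}  {false ∷ T} S⊆T = ⊥-elim (true∷⊈false∷ S⊆T)

applySwaps-≽ : (d : DisjointSwaps u v) (S : Subset (#swaps d)) → u ≼ applySwaps d S
applySwaps-≽ d S = subst (_≼ applySwaps d S) (applySwaps-∅ d) (applySwaps-mono d ⊥⊆)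

applySwaps-≼ : (d : DisjointSwaps u v) (S : Subset (#swaps d)) → applySwaps d S ≼ v
applySwaps-≼ d S = subst (applySwaps d S ≼_) (applySwaps-⊤ d) (applySwaps-mono d ⊆⊤)

DisjointSwaps⇒≼ : DisjointSwaps u v → u ≼ v
DisjointSwaps⇒≼ d = subst (_ ≼_) (applySwaps-⊤ d) (applySwaps-≽ d full)

applySwaps-injective : (d : DisjointSwaps u v) {S T : Subset (#swaps d)} → applySwaps d S ≡ applySwaps d T → S ≡ T
applySwaps-injective []           {[]}        {[]}        _ = refl
applySwaps-injective (keep x d)                           e = applySwaps-injective d (∷-injectiveʳ e)
applySwaps-injective (swap x<y d) {true ∷ S}  {true ∷ T}  e = cong (true ∷_) (applySwaps-injective d (∷-injectiveʳ (∷-injectiveʳ e)))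
applySwaps-injective (swap x<y d) {false ∷ S} {false ∷ T} e = cong (false ∷_) (applySwaps-injective d (∷-injectiveʳ (∷-injectiveʳ e)))
applySwaps-injective (swap x<y d) {true ∷ S}  {false ∷ T} e = ⊥-elim (<-irrefl (sym (∷-injectiveˡ e)) x<y)
applySwaps-injective (swap x<y d) {false ∷ S} {true ∷ T}  e = ⊥-elim (<-irrefl (∷-injectiveˡ e) x<y)

applySwaps-reflects : (d : DisjointSwaps u v) {S T : Subset (#swaps d)} → Distinct u →
  applySwaps d S ⊆Inv applySwaps d T → S ⊆ T
applySwaps-reflects [] {[]} {[]} _ _ = ⊆-refl
applySwaps-reflects (keep x d) {S} (x∉u ∷ du) inv =
  applySwaps-reflects d du λ a<b q → Before-tail (inv a<b (later q)) (∉⇒≢ x∉u (tail∈ (Before-∈ˡ q)))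
  where
  tail∈ : z ∈ᵥ applySwaps d S → z ∈ᵥ _
  tail∈ = ≼-∈⁻ (applySwaps-≽ d S)
applySwaps-reflects (swap {x = x} {y} x<y d) {s ∷ S} {t ∷ T} (x∉yu ∷ (y∉u ∷ du)) inv =
  cons⊆ s t inv (applySwaps-reflects d du (tail⊆ s t inv))
  where
  x∉u : x ∉ᵥ _
  x∉u p = x∉yu (there p)
  tail∈ : z ∈ᵥ applySwaps d S → z ∈ᵥ _
  tail∈ = ≼-∈⁻ (applySwaps-≽ d S)
  Inv = λ s t → applySwaps (swap x<y d) (s ∷ S) ⊆Inv applySwaps (swap x<y d) (t ∷ T)
  cons⊆ : ∀ s t → Inv s t → S ⊆ T → (s ∷ S) ⊆ (t ∷ T)
  cons⊆ true  true  _   = s⊆s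
  cons⊆ false _     _   = out⊆
  cons⊆ true  false inv = ⊥-elim (¬Before-head x∉yT (inv x<y (now (here refl))))
    where
    x∉yT : x ∉ᵥ (y ∷ applySwaps d T)
    x∉yT (here x≡y) = <-irrefl x≡y x<y
    x∉yT (there p)  = x∉u (≼-∈⁻ (applySwaps-≽ d T) p)
  tail⊆ : ∀ s t → Inv s t → applySwaps d S ⊆Inv applySwaps d T
  tail⊆ s t inv a<b q with ∉⇒≢ x∉u (tail∈ (Before-∈ˡ q)) | ∉⇒≢ y∉u (tail∈ (Before-∈ˡ q))
  tail⊆ true  true  inv a<b q | b≢x | b≢y = Before-tail (Before-tail (inv a<b (later (later q))) b≢y) b≢x
  tail⊆ true  false inv a<b q | b≢x | b≢y = Before-tail (Before-tail (inv a<b (later (later q))) b≢x) b≢y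
  tail⊆ false true  inv a<b q | b≢x | b≢y = Before-tail (Before-tail (inv a<b (later (later q))) b≢y) b≢x
  tail⊆ false false inv a<b q | b≢x | b≢y = Before-tail (Before-tail (inv a<b (later (later q))) b≢x) b≢y

record Between {n m : ℕ} (u v w : Vec (Fin n) m) : Set where
  constructor between
  field
    distinctˡ : Distinct u
    distinct  : Distinct v
    distinctʳ : Distinct w
    ∈ˡ⇒∈      : ∀ {z} → z ∈ᵥ u → z ∈ᵥ v
    ∈⇒∈ˡ      : ∀ {z} → z ∈ᵥ v → z ∈ᵥ u
    invˡ      : u ⊆Inv v
    invʳ      : v ⊆Inv w

Between-Before : Between u v w → Before c z u → Before c z w → Before c z v
Between-Before {c = c} {z = z} (between du dv dw ∈ˡ⇒∈ _ invˡ invʳ) p q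
  with Before-total (∈ˡ⇒∈ (Before-∈ˡ p)) (∈ˡ⇒∈ (Before-∈ʳ p)) (Before-≢ du p)
... | inj₁ r = r
... | inj₂ r with <-cmp c z
...   | tri< c<z _ _ = ⊥-elim (Before-asym dw q (invʳ c<z r))
...   | tri≈ _ c≡z _ = ⊥-elim (Before-≢ du p c≡z)
...   | tri> _ _ z<c = ⊥-elim (Before-asym dv (invˡ z<c p) r)

Between-drop₁ : Between (x ∷ u) (x ∷ v) (x ∷ w) → Between u v w
Between-drop₁ (between (x∉u ∷ du) (x∉v ∷ dv) (_ ∷ dw) ∈ˡ⇒∈ ∈⇒∈ˡ invˡ invʳ) =
  between du dv dw
    (λ z∈u → ∈-∷⁻ (∈ˡ⇒∈ (there z∈u)) (∉⇒≢ x∉u z∈u))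
    (λ z∈v → ∈-∷⁻ (∈⇒∈ˡ (there z∈v)) (∉⇒≢ x∉v z∈v))
    (λ a<b q → Before-tail (invˡ a<b (later q)) (∉⇒≢ x∉u (Before-∈ˡ q)))
    (λ a<b q → Before-tail (invʳ a<b (later q)) (∉⇒≢ x∉v (Before-∈ˡ q)))

Between-drop₂ : {p q : Fin n} → p ∉ᵥ u → q ∉ᵥ u → x ∉ᵥ v → y ∉ᵥ v →
  Between (x ∷ y ∷ u) (p ∷ q ∷ v) (y ∷ x ∷ w) → Between u v w
Between-drop₂ p∉u q∉u x∉v y∉v (between du dv dw ∈ˡ⇒∈ ∈⇒∈ˡ invˡ invʳ) =
  between (Distinct-tail (Distinct-tail du)) (Distinct-tail (Distinct-tail dv)) (Distinct-tail (Distinct-tail dw))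
    (λ z∈u → ∈-∷⁻ (∈-∷⁻ (∈ˡ⇒∈ (there (there z∈u))) (∉⇒≢ p∉u z∈u)) (∉⇒≢ q∉u z∈u))
    (λ z∈v → ∈-∷⁻ (∈-∷⁻ (∈⇒∈ˡ (there (there z∈v))) (∉⇒≢ x∉v z∈v)) (∉⇒≢ y∉v z∈v))
    (λ a<b r → Before-tail (Before-tail (invˡ a<b (later (later r))) (∉⇒≢ p∉u (Before-∈ˡ r))) (∉⇒≢ q∉u (Before-∈ˡ r)))
    (λ a<b r → Before-tail (Before-tail (invʳ a<b (later (later r))) (∉⇒≢ y∉v (Before-∈ˡ r))) (∉⇒≢ x∉v (Before-∈ˡ r)))

Between⇒applySwaps : (d : DisjointSwaps u w) → Between u v w → ∃ λ S → applySwaps d S ≡ v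
Between⇒applySwaps {v = []} [] _ = [] , refl
Between⇒applySwaps {v = p ∷ v} (keep x d) h with Between.∈⇒∈ˡ h (here refl)
... | here refl = let S , e = Between⇒applySwaps d (Between-drop₁ h) in S , cong (x ∷_) e
... | there p∈u =
  ⊥-elim (¬Before-head (Distinct-head (Between.distinct h))
           (Between-Before h (now p∈u) (now (≼-∈ (DisjointSwaps⇒≼ d) p∈u))))
Between⇒applySwaps {u = x ∷ y ∷ u} {v = p ∷ q ∷ v} (swap x<y d) h =
  heads (Between.∈⇒∈ˡ h (here refl)) (Between.∈⇒∈ˡ h (there (here refl)))
  where
  dv = Between.distinct h
  x∉u : x ∉ᵥ u
  x∉u r = Distinct-head (Between.distinctˡ h) (there r)
  y∉u : y ∉ᵥ u
  y∉u = Distinct-head (Distinct-tail (Between.distinctˡ h))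
  p∉v : p ∉ᵥ v
  p∉v r = Distinct-head dv (there r)
  q∉v : q ∉ᵥ v
  q∉v = Distinct-head (Distinct-tail dv)
  x-before : z ∈ᵥ u → Before x z (p ∷ q ∷ v)
  x-before r = Between-Before h (now (there r)) (later (now (≼-∈ (DisjointSwaps⇒≼ d) r)))
  y-before : z ∈ᵥ u → Before y z (p ∷ q ∷ v)
  y-before r = Between-Before h (later (now r)) (now (there (≼-∈ (DisjointSwaps⇒≼ d) r)))
  -- An entry of u comes after both x and y in v, so it can be neither p nor q.
  heads : p ∈ᵥ (x ∷ y ∷ u) → q ∈ᵥ (x ∷ y ∷ u) → ∃ λ S → applySwaps (swap x<y d) S ≡ p ∷ q ∷ v
  heads (there (there r)) _ = ⊥-elim (¬Before-head (Distinct-head dv) (x-before r))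
  heads _ (there (there r)) = ⊥-elim (<-irrefl (trans (Before-second dv (x-before r)) (sym (Before-second dv (y-before r)))) x<y)
  heads (here refl)         (here refl)         = ⊥-elim (Distinct-head dv (here refl))
  heads (there (here refl)) (there (here refl)) = ⊥-elim (Distinct-head dv (here refl))
  heads (here refl) (there (here refl)) =
    let S , e = Between⇒applySwaps d (Between-drop₂ x∉u y∉u p∉v q∉v h) in false ∷ S , cong (λ r → x ∷ y ∷ r) e
  heads (there (here refl)) (here refl) =
    let S , e = Between⇒applySwaps d (Between-drop₂ y∉u x∉u q∉v p∉v h) in true ∷ S , cong (λ r → y ∷ x ∷ r) e

≼-antisym : Distinct u → Distinct v → u ≼ v → v ≼ u → u ≡ v
≼-antisym {u = u} du dv u≼v v≼u =
  let S , e = Between⇒applySwaps (noSwaps u) (between du dv du (≼-∈ u≼v) (≼-∈⁻ u≼v) (≼-⊆Inv u≼v) (≼-⊆Inv v≼u))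
  in trans (sym (applyNoSwaps u S)) e

DisjointSwaps-Distinct : DisjointSwaps u v → Distinct u → Distinct v
DisjointSwaps-Distinct d = ≼-Distinct (DisjointSwaps⇒≼ d)

DisjointSwaps-tail : DisjointSwaps (x ∷ u) (x ∷ v) → DisjointSwaps u v
DisjointSwaps-tail (keep _ d)   = d
DisjointSwaps-tail (swap x<x _) = ⊥-elim (<-irrefl refl x<x)

-- An ascent x y that is still adjacent after the swaps of d was untouched by them.
DisjointSwaps-extend : x <ᶠ y → DisjointSwaps u v → Swap x y u t → Swap x y v w → Distinct u → DisjointSwaps u w
DisjointSwaps-extend x<y (keep z d) (swap-tail s) (swap-tail s′) du =
  keep z (DisjointSwaps-extend x<y d s s′ (Distinct-tail du))
DisjointSwaps-extend x<y (keep z d) swap-head swap-head _ = swap x<y (DisjointSwaps-tail d)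
DisjointSwaps-extend x<y (keep z d) swap-head (swap-tail s′) du =
  ⊥-elim (Distinct-head (DisjointSwaps-Distinct (keep z d) du) (Swap-∈ˡ s′))
DisjointSwaps-extend x<y (keep z d) (swap-tail s) swap-head du = ⊥-elim (Distinct-head du (Swap-∈ˡ s))
DisjointSwaps-extend x<y (swap y<x d) swap-head swap-head _ = ⊥-elim (<-asym x<y y<x)
DisjointSwaps-extend x<y (swap p d) swap-head (swap-tail swap-head) du =
  ⊥-elim (Distinct-head (DisjointSwaps-Distinct (swap p d) du) (there (here refl)))
DisjointSwaps-extend x<y (swap p d) swap-head (swap-tail (swap-tail s′)) du =
  ⊥-elim (Distinct-head (Distinct-tail (DisjointSwaps-Distinct (swap p d) du)) (Swap-∈ˡ s′))
DisjointSwaps-extend x<y (swap p d) (swap-tail swap-head) swap-head du = ⊥-elim (Distinct-head du (there (here refl)))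
DisjointSwaps-extend x<y (swap x<x d) (swap-tail swap-head) (swap-tail swap-head) _ = ⊥-elim (<-irrefl refl x<x)
DisjointSwaps-extend x<y (swap p d) (swap-tail swap-head) (swap-tail (swap-tail s′)) du =
  ⊥-elim (Distinct-head (DisjointSwaps-Distinct (swap p d) du) (there (Swap-∈ˡ s′)))
DisjointSwaps-extend x<y (swap p d) (swap-tail (swap-tail s)) swap-head du = ⊥-elim (Distinct-head (Distinct-tail du) (Swap-∈ˡ s))
DisjointSwaps-extend x<y (swap p d) (swap-tail (swap-tail s)) (swap-tail swap-head) du =
  ⊥-elim (Distinct-head du (there (Swap-∈ˡ s)))
DisjointSwaps-extend x<y (swap p d) (swap-tail (swap-tail s)) (swap-tail (swap-tail s′)) du =
  swap p (DisjointSwaps-extend x<y d s s′ (Distinct-tail (Distinct-tail du)))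

record BooleanMap {n : ℕ} (π w : Vec (Fin n) n) (k : ℕ) (f : Subset k → Vec (Fin n) n) : Set where
  field
    inInterval : ∀ S → InInterval π w (f S)
    onto       : ∀ u → InInterval π w u → ∃ λ S → f S ≡ u
    injective  : ∀ S T → f S ≡ f T → S ≡ T
    order      : ∀ S T → (S ⊆ T) ⇔ (f S ≤W f T)

  image-Distinct : ∀ S → Distinct (f S)
  image-Distinct S = IsPerm⇒Distinct (proj₁ (inInterval S))

  ≤-image : ∀ S → π ≤W f S
  ≤-image S = proj₁ (proj₂ (inInterval S))

  image-≤ : ∀ S → f S ≤W w
  image-≤ S = proj₂ (proj₂ (inInterval S))

  bottom≤top : π ≤W w
  bottom≤top = ≤-image ∅ ◅◅ image-≤ ∅

BooleanMap⇒IsBoolean : {π w : Vec (Fin n) n} {k : ℕ} {f : Subset k → Vec (Fin n) n} → BooleanMap π w k f → IsBoolean π w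
BooleanMap⇒IsBoolean {k = k} {f} B = bottom≤top , k , f , inInterval , onto , injective , order
  where open BooleanMap B

IsBoolean⇒BooleanMap : {π w : Vec (Fin n) n} → ((_ , k , f , _) : IsBoolean π w) → BooleanMap π w k f
IsBoolean⇒BooleanMap (_ , _ , _ , inInterval , onto , injective , order) = record
  { inInterval = inInterval ; onto = onto ; injective = injective ; order = order }

DisjointSwaps⇒BooleanMap : {π w : Vec (Fin n) n} → Distinct π → (d : DisjointSwaps π w) → BooleanMap π w (#swaps d) (applySwaps d)
DisjointSwaps⇒BooleanMap {π = π} {w} dπ d = record
  { inInterval = λ S → Distinct⇒IsPerm (≼-Distinct (applySwaps-≽ d S) dπ) , applySwaps-≽ d S , applySwaps-≼ d S
  ; onto       = onto
  ; injective  = λ _ _ → applySwaps-injective d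
  ; order      = λ S T → mk⇔ (applySwaps-mono d) (λ S≤T → applySwaps-reflects d dπ (≼-⊆Inv S≤T))
  }
  where
  onto : ∀ u → InInterval π w u → ∃ λ S → applySwaps d S ≡ u
  onto u (pu , π≤u , u≤w) = Between⇒applySwaps d
    (between dπ (IsPerm⇒Distinct pu) (DisjointSwaps-Distinct d dπ) (≼-∈ π≤u) (≼-∈⁻ π≤u) (≼-⊆Inv π≤u) (≼-⊆Inv u≤w))

module _ {π w : Vec (Fin n) n} {k : ℕ} {f : Subset k → Vec (Fin n) n} (B : BooleanMap π w k f) where
  open BooleanMap B
  open Equivalence

  BooleanMap-∅ : Distinct π → f ∅ ≡ π
  BooleanMap-∅ dπ =
    let S , e = onto π (Distinct⇒IsPerm dπ , ε , bottom≤top)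
    in ≼-antisym (image-Distinct ∅) dπ (subst (f ∅ ≼_) e (to (order ∅ S) ⊥⊆)) (≤-image ∅)

  BooleanMap-⊤ : Distinct w → f full ≡ w
  BooleanMap-⊤ dw =
    let S , e = onto w (Distinct⇒IsPerm dw , bottom≤top , ε)
    in ≼-antisym (image-Distinct full) dw (image-≤ full) (subst (_≼ f full) e (to (order S full) ⊆⊤))

module _ {π w : Vec (Fin n) n} {k : ℕ} {f : Subset (suc k) → Vec (Fin n) n} (B : BooleanMap π w (suc k) f) where
  open BooleanMap B
  open Equivalence

  facet : Vec (Fin n) n
  facet = f (false ∷ full)

  atom : Vec (Fin n) n
  atom = f (true ∷ ∅)

  facet-BooleanMap : BooleanMap π facet k (λ S → f (false ∷ S))
  facet-BooleanMap = record
    { inInterval = λ S → proj₁ (inInterval (false ∷ S)) , ≤-image (false ∷ S) , to (order _ _) (out⊆ ⊆⊤)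
    ; onto       = facet-onto
    ; injective  = λ S T e → ∷-injectiveʳ (injective _ _ e)
    ; order      = λ S T → mk⇔ (λ (S⊆T : S ⊆ T) → to (order _ _) (out⊆ S⊆T)) (λ le → drop-∷-⊆ (from (order _ _) le))
    }
    where
    facet-onto : ∀ u → InInterval π facet u → ∃ λ S → f (false ∷ S) ≡ u
    facet-onto u (pu , π≤u , u≤facet) with onto u (pu , π≤u , u≤facet ◅◅ image-≤ (false ∷ full))
    ... | true  ∷ T , e = ⊥-elim (true∷⊈false∷ (from (order _ _) (subst (_≼ facet) (sym e) u≤facet)))
    ... | false ∷ T , e = T , e

  atom⋠facet : ¬ (atom ≤W facet)
  atom⋠facet le = true∷⊈false∷ (from (order _ _) le)

  facet⋖top : Distinct w → AscentSwap facet w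
  facet⋖top dw with ≼-uncons (image-≤ (false ∷ full))
  ... | inj₁ e = contradiction (∷-injectiveˡ (injective _ _ (trans e (sym (BooleanMap-⊤ B dw))))) λ ()
  ... | inj₂ (v , facet⋖v , v≤w) with onto v (Distinct⇒IsPerm (≼-Distinct (facet⋖v ◅ ε) (image-Distinct _)) , ≤-image _ ◅◅ facet⋖v ◅ ε , v≤w)
  ...   | t ∷ T , e with ⊆-antisym ⊆⊤ (drop-∷-⊆ (from (order _ _) (subst (facet ≼_) (sym e) (facet⋖v ◅ ε))))
  ...     | refl with t
  ...       | false = ⊥-elim (Cover⇒≢ facet⋖v e)
  ...       | true  = subst (AscentSwap facet) (trans (sym e) (BooleanMap-⊤ B dw)) (Cover⇒AscentSwap facet⋖v)

  bottom⋖atom : Distinct π → AscentSwap π atom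
  bottom⋖atom dπ with ≼-uncons (≤-image (true ∷ ∅))
  ... | inj₁ e = contradiction (∷-injectiveˡ (injective _ _ (trans (BooleanMap-∅ B dπ) e))) λ ()
  ... | inj₂ (v , π⋖v , v≤atom) with onto v (Distinct⇒IsPerm (≼-Distinct (π⋖v ◅ ε) dπ) , π⋖v ◅ ε , v≤atom ◅◅ image-≤ _)
  ...   | t ∷ T , e with ⊆-antisym (drop-∷-⊆ (from (order _ _) (subst (_≼ atom) (sym e) v≤atom))) ⊥⊆
  ...     | refl with t
  ...       | false = ⊥-elim (Cover⇒≢ π⋖v (trans (sym (BooleanMap-∅ B dπ)) e))
  ...       | true  = subst (AscentSwap π) (sym e) (Cover⇒AscentSwap π⋖v)

  -- The inversion created by the atom lies in w. Were it already in the facet, the atom would lie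
  -- in [π, facet]; so it is the one created by the top cover, whose swap thus occurs in π itself.
  DisjointSwaps-facet⇒top : Distinct π → Distinct w → DisjointSwaps π facet → DisjointSwaps π w
  DisjointSwaps-facet⇒top dπ dw d with bottom⋖atom dπ | facet⋖top dw
  ... | ascentSwap x′<y′ s′ | ascentSwap x<y s
    with Swap-Before⁻ s (≼-⊆Inv (image-≤ (true ∷ ∅)) x′<y′ (Swap-creates s′))
  ... | inj₂ (refl , refl) = DisjointSwaps-extend x<y d s′ s dπ
  ... | inj₁ y′x′∈facet =
    let S , e = Between⇒applySwaps d (between dπ (Swap-Distinct s′ dπ) (image-Distinct _)
                                         (Swap-∈ s′) (Swap-∈⁻ s′) (Swap-⊆Inv x′<y′ s′) atom⊆Invfacet)
    in ⊥-elim (atom⋠facet (subst (_≼ facet) e (applySwaps-≼ d S)))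
    where
    atom⊆Invfacet : atom ⊆Inv facet
    atom⊆Invfacet a<b q with Swap-Before⁻ s′ q
    ... | inj₁ r             = ≼-⊆Inv (≤-image _) a<b r
    ... | inj₂ (refl , refl) = y′x′∈facet

Boolean⇒DisjointSwaps : ∀ k {π w : Vec (Fin n) n} {f : Subset k → Vec (Fin n) n} →
  Distinct π → Distinct w → BooleanMap π w k f → DisjointSwaps π w
Boolean⇒DisjointSwaps zero {π} dπ dw B =
  subst (DisjointSwaps π) (trans (sym (BooleanMap-∅ B dπ)) (BooleanMap-⊤ B dw)) (noSwaps π)
Boolean⇒DisjointSwaps (suc k) dπ dw B =
  DisjointSwaps-facet⇒top B dπ dw
    (Boolean⇒DisjointSwaps k dπ (BooleanMap.image-Distinct B _) (facet-BooleanMap B))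

swappedFront : Bool → Fin n → Fin n → List (Vec (Fin n) m) → List (Vec (Fin n) (suc (suc m)))
swappedFront true  x y vs = map (λ v → y ∷ x ∷ v) vs
swappedFront false _ _ _  = []

disjointSwapsOf : Vec (Fin n) m → List (Vec (Fin n) m)
disjointSwapsOf []          = [] ∷ []
disjointSwapsOf (x ∷ [])    = (x ∷ []) ∷ []
disjointSwapsOf (x ∷ y ∷ u) =
  map (x ∷_) (disjointSwapsOf (y ∷ u)) ++ swappedFront (toℕ x <ᵇ toℕ y) x y (disjointSwapsOf u)

∈-disjointSwapsOf⁻ : (u : Vec (Fin n) m) → w ∈ disjointSwapsOf u → DisjointSwaps u w
∈-disjointSwapsOf⁻ []          (ListAny.here refl) = []
∈-disjointSwapsOf⁻ (x ∷ [])    (ListAny.here refl) = keep x []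
∈-disjointSwapsOf⁻ (x ∷ y ∷ u) w∈ with ∈-++⁻ (map (x ∷_) (disjointSwapsOf (y ∷ u))) w∈
... | inj₁ w∈kept with ∈-map⁻ (x ∷_) w∈kept
...   | v , v∈ , refl = keep x (∈-disjointSwapsOf⁻ (y ∷ u) v∈)
∈-disjointSwapsOf⁻ (x ∷ y ∷ u) w∈ | inj₂ w∈swapped = swapped (toℕ x <ᵇ toℕ y) (<ᵇ⇒< _ _) w∈swapped
  where
  swapped : ∀ b → (T b → x <ᶠ y) → w ∈ swappedFront b x y (disjointSwapsOf u) → DisjointSwaps (x ∷ y ∷ u) w
  swapped true x<y w∈ with ∈-map⁻ (λ v → y ∷ x ∷ v) w∈
  ... | v , v∈ , refl = swap (x<y tt) (∈-disjointSwapsOf⁻ u v∈)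

∈-disjointSwapsOf⁺ : DisjointSwaps u w → w ∈ disjointSwapsOf u
∈-disjointSwapsOf⁺ []                      = ListAny.here refl
∈-disjointSwapsOf⁺ (keep {u = []} x [])      = ListAny.here refl
∈-disjointSwapsOf⁺ (keep {u = _ ∷ _} x d)    = ∈-++⁺ˡ (∈-map⁺ (x ∷_) (∈-disjointSwapsOf⁺ d))
∈-disjointSwapsOf⁺ (swap {x = x} {y = y} {u = u} {v = v} x<y d) =
  ∈-++⁺ʳ (map (x ∷_) (disjointSwapsOf (y ∷ u))) (swapped (toℕ x <ᵇ toℕ y) (<⇒<ᵇ x<y))
  where
  swapped : ∀ b → T b → (y ∷ x ∷ v) ∈ swappedFront b x y (disjointSwapsOf u)
  swapped true _ = ∈-map⁺ (λ v → y ∷ x ∷ v) (∈-disjointSwapsOf⁺ d)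

disjointSwapsOf-Unique : (u : Vec (Fin n) m) → Unique (disjointSwapsOf u)
disjointSwapsOf-Unique []       = ListAll.[] AllPairs.∷ AllPairs.[]
disjointSwapsOf-Unique (x ∷ []) = ListAll.[] AllPairs.∷ AllPairs.[]
disjointSwapsOf-Unique (x ∷ y ∷ u) =
  Unique.++⁺ (Unique.map⁺ ∷-injectiveʳ (disjointSwapsOf-Unique (y ∷ u)))
             (swapped-Unique (toℕ x <ᵇ toℕ y))
             (λ (kept , swapped) → kept≢swapped (toℕ x <ᵇ toℕ y) (<ᵇ⇒< _ _) kept swapped)
  where
  swapped-Unique : ∀ b → Unique (swappedFront b x y (disjointSwapsOf u))
  swapped-Unique true  = Unique.map⁺ (λ e → ∷-injectiveʳ (∷-injectiveʳ e)) (disjointSwapsOf-Unique u)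
  swapped-Unique false = AllPairs.[]
  kept≢swapped : ∀ b → (T b → x <ᶠ y) → w ∈ map (x ∷_) (disjointSwapsOf (y ∷ u)) → ¬ w ∈ swappedFront b x y (disjointSwapsOf u)
  kept≢swapped true x<y kept swapped with ∈-map⁻ (x ∷_) kept | ∈-map⁻ (λ v → y ∷ x ∷ v) swapped
  ... | _ , _ , refl | _ , _ , x≡y = <-irrefl (∷-injectiveˡ x≡y) (x<y tt)

-- The number of sets of pairwise non-consecutive positions of bs that hold true.
sparseSubsets : List Bool → ℕ
sparseSubsets []                = 1
sparseSubsets (false ∷ bs)      = sparseSubsets bs
sparseSubsets (true ∷ [])       = 2
sparseSubsets (true ∷ b ∷ bs)   = sparseSubsets (b ∷ bs) + sparseSubsets bs

sparseSubsets-true∷ascBits : ∀ a as → sparseSubsets (true ∷ ascBits (a ∷ as)) ≡ sparseSubsets (ascBits (a ∷ as)) + sparseSubsets (ascBits as)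
sparseSubsets-true∷ascBits a []      = refl
sparseSubsets-true∷ascBits a (_ ∷ _) = refl

length-disjointSwapsOf : (u : Vec (Fin n) m) → length (disjointSwapsOf u) ≡ sparseSubsets (ascBits (map toℕ (toList u)))
length-disjointSwapsOf []       = refl
length-disjointSwapsOf (x ∷ []) = refl
length-disjointSwapsOf (x ∷ y ∷ u)
  with toℕ x <ᵇ toℕ y | length-disjointSwapsOf (y ∷ u) | length-disjointSwapsOf u
... | false | ih₁ | _ = begin
  length (map (x ∷_) (disjointSwapsOf (y ∷ u)) ++ [])   ≡⟨ cong length (++-identityʳ (map (x ∷_) (disjointSwapsOf (y ∷ u)))) ⟩
  length (map (x ∷_) (disjointSwapsOf (y ∷ u)))        ≡⟨ length-map (x ∷_) (disjointSwapsOf (y ∷ u)) ⟩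
  length (disjointSwapsOf (y ∷ u))                      ≡⟨ ih₁ ⟩
  sparseSubsets (ascBits (map toℕ (toList (y ∷ u))))    ∎
  where open ≡-Reasoning
... | true | ih₁ | ih₂ = begin
  length (map (x ∷_) (disjointSwapsOf (y ∷ u)) ++ map (λ v → y ∷ x ∷ v) (disjointSwapsOf u))
    ≡⟨ length-++ (map (x ∷_) (disjointSwapsOf (y ∷ u))) ⟩
  length (map (x ∷_) (disjointSwapsOf (y ∷ u))) + length (map (λ v → y ∷ x ∷ v) (disjointSwapsOf u))
    ≡⟨ cong₂ _+_ (length-map (x ∷_) (disjointSwapsOf (y ∷ u))) (length-map (λ v → y ∷ x ∷ v) (disjointSwapsOf u)) ⟩
  length (disjointSwapsOf (y ∷ u)) + length (disjointSwapsOf u)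
    ≡⟨ cong₂ _+_ ih₁ ih₂ ⟩
  sparseSubsets (ascBits (map toℕ (toList (y ∷ u)))) + sparseSubsets (ascBits (map toℕ (toList u)))
    ≡⟨ sym (sparseSubsets-true∷ascBits (toℕ y) (map toℕ (toList u))) ⟩
  sparseSubsets (true ∷ ascBits (map toℕ (toList (y ∷ u)))) ∎
  where open ≡-Reasoning

∏fib : List ℕ → ℕ
∏fib bs = product (map (λ b → fib (b + 2)) bs)

fib-+2 : ∀ c → fib (c + 2) ≡ fib (suc (suc c))
fib-+2 c = cong fib (+-comm c 2)

-- The hypotheses on bs hold when bs is empty or starts with false, i.e. at the end of a block of c ascents.
sparseSubsets-run : ∀ bs X → sparseSubsets bs ≡ X → sparseSubsets (true ∷ bs) ≡ X + X →
  ∀ c → sparseSubsets (replicate c true ++ bs) ≡ fib (suc (suc c)) * X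
sparseSubsets-run bs X e₀ e₁ zero          = trans e₀ (sym (+-identityʳ X))
sparseSubsets-run bs X e₀ e₁ (suc zero)    = trans e₁ (cong (X +_) (sym (+-identityʳ X)))
sparseSubsets-run bs X e₀ e₁ (suc (suc c)) =
  trans (cong₂ _+_ (sparseSubsets-run bs X e₀ e₁ (suc c)) (sparseSubsets-run bs X e₀ e₁ c))
        (sym (*-distribʳ-+ X (fib (suc (suc (suc c)))) (fib (suc (suc c)))))

∏fib-closeRun : ∀ c → ∏fib (closeRun c) ≡ fib (suc (suc c))
∏fib-closeRun zero    = refl
∏fib-closeRun (suc c) = trans (*-identityʳ _) (fib-+2 (suc c))

replicate-∷ʳ : ∀ c (bs : List Bool) → replicate c true ++ true ∷ bs ≡ replicate (suc c) true ++ bs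
replicate-∷ʳ zero    bs = refl
replicate-∷ʳ (suc c) bs = cong (true ∷_) (replicate-∷ʳ c bs)

sparseSubsets≡∏fib : ∀ bs c → sparseSubsets (replicate c true ++ bs) ≡ ∏fib (runs c bs)
sparseSubsets≡∏fib [] c = begin
  sparseSubsets (replicate c true ++ [])  ≡⟨ sparseSubsets-run [] 1 refl refl c ⟩
  fib (suc (suc c)) * 1                   ≡⟨ *-identityʳ _ ⟩
  fib (suc (suc c))                       ≡⟨ ∏fib-closeRun c ⟨
  ∏fib (closeRun c)                       ∎
  where open ≡-Reasoning
sparseSubsets≡∏fib (true ∷ bs) c =
  trans (cong sparseSubsets (replicate-∷ʳ c bs)) (sparseSubsets≡∏fib bs (suc c))
sparseSubsets≡∏fib (false ∷ bs) c = begin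
  sparseSubsets (replicate c true ++ false ∷ bs)            ≡⟨ sparseSubsets-run (false ∷ bs) _ refl refl c ⟩
  fib (suc (suc c)) * sparseSubsets bs                      ≡⟨ cong₂ _*_ (sym (∏fib-closeRun c)) (sparseSubsets≡∏fib bs 0) ⟩
  ∏fib (closeRun c) * ∏fib (runs 0 bs)                      ≡⟨ product-++ (map _ (closeRun c)) (map _ (runs 0 bs)) ⟨
  product (map _ (closeRun c) ++ map _ (runs 0 bs))         ≡⟨ cong product (map-++ _ (closeRun c) (runs 0 bs)) ⟨
  ∏fib (closeRun c ++ runs 0 bs)                            ∎
  where open ≡-Reasoning

theorem1p1 : (n : ℕ) → 1 ≤ n → (π : Vec (Fin n) n) → IsPerm π →
    Σ (List (Vec (Fin n) n)) λ ws →
      Unique ws ×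
      (∀ w → (w ∈ ws) ⇔ (IsPerm w × IsBoolean π w)) ×
      (length ws ≡ fibProduct π)
theorem1p1 n _ π pπ =
  disjointSwapsOf π ,
  disjointSwapsOf-Unique π ,
  (λ w → mk⇔ boolean (∈-disjointSwapsOf⁺ ∘ disjointSwaps)) ,
  trans (length-disjointSwapsOf π) (sparseSubsets≡∏fib (ascBits (map toℕ (toList π))) 0)
  where
  dπ = IsPerm⇒Distinct pπ
  boolean : ∀ {w} → w ∈ disjointSwapsOf π → IsPerm w × IsBoolean π w
  boolean w∈ =
    let d = ∈-disjointSwapsOf⁻ π w∈
    in Distinct⇒IsPerm (DisjointSwaps-Distinct d dπ) , BooleanMap⇒IsBoolean (DisjointSwaps⇒BooleanMap dπ d)
  disjointSwaps : ∀ {w} → IsPerm w × IsBoolean π w → DisjointSwaps π w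
  disjointSwaps (pw , boolean@(_ , k , _)) =
    Boolean⇒DisjointSwaps k dπ (IsPerm⇒Distinct pw) (IsBoolean⇒BooleanMap boolean)
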